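{- Let $G$ be a graph, let $k\in\mathbb N$, and let $D$ be a multiset of vertices of $G$ (in particular, $D$ may be a set). The following are equivalent: (i) $D$ counters every multiset $A$ of vertices of $G$ with $|A|\le k$; (ii) for every vertex $v\in V(G)$, $\sum_{u\in N[v]} m(u,D)\ge k$. Consequently, for all $G,k,\ell$, the instance $(G,k,\ell)$ is a yes-instance of Defensive Dominating Set with Multiset Attack if and only if it is a yes-instance of $k$-tuple Dominating Set. This holds when defenses and $k$-tuple dominating sets are both required to be sets, and also when both may be multisets.
   Context: Graphs are finite, simple and undirected. $N[v]=\{v\}\cup\{u:\{u,v\}\in E(G)\}$ is the closed neighborhood of $v$. For a multiset $X$, $m(x,X)\in\mathbb N_0$ denotes the multiplicity of $x$ in $X$. A multiset $D$ of vertices counters a multiset $A$ of vertices if there is an injective map from the tokens of $A$ to the tokens of $D$ (each copy counts as a separate token) sending each attacker token located at $a$ to a defender token located at some $d$ with $a\in N[d]$. Defensive Dominating Set with Multiset Attack is the following decision problem. The input is $G,k,\ell$. The question is whether there is a defense $D$ of vertices with $|D|\le\ell$ that counters every multiset $A$ of vertices with $|A|\le k$. $k$-tuple Dominating Set is the following decision problem. The input is $G,k,\ell$. The question is whether there is $D$ of vertices with $|D|\le\ell$ such that $\sum_{u\in N[v]}m(u,D)\ge k$ for every $v\in V(G)$. -}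

module Defs where

open import Data.Nat using (ℕ; _≤_)
open import Data.Fin using (Fin; _≟_)
open import Data.Bool using (Bool; true; false; _∨_; if_then_else_; T)
open import Data.List using (List; map; allFin)
open import Data.Nat.ListAction using (sum)
open import Data.Product using (Σ; _×_; proj₁)
open import Relation.Binary.PropositionalEquality using (_≡_)
open import Relation.Nullary.Decidable using (⌊_⌋)
open import Function.Definitions using (Injective)

record Graph : Set where
  field
    n     : ℕ
    adj   : Fin n → Fin n → Bool
    sym   : ∀ u v → adj u v ≡ adj v u
    irref : ∀ v → adj v v ≡ false

open Graph public

-- A multiset of vertices: its multiplicity function m(·,X).
Multiset : Graph → Set
Multiset G = Fin (n G) → ℕ

size : (G : Graph) → Multiset G → ℕ
size G X = sum (map X (allFin (n G)))

IsSet : (G : Graph) → Multiset G → Set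
IsSet G X = ∀ v → X v ≤ 1

inN : (G : Graph) → Fin (n G) → Fin (n G) → Bool
inN G u v = ⌊ u ≟ v ⌋ ∨ adj G v u

-- Tokens of a multiset: a location v together with a copy index < m(v,X).
Token : (G : Graph) → Multiset G → Set
Token G X = Σ (Fin (n G)) (λ v → Fin (X v))

Counters : (G : Graph) → Multiset G → Multiset G → Set
Counters G D A =
  Σ (Token G A → Token G D) λ f →
    Injective _≡_ _≡_ f × (∀ t → T (inN G (proj₁ t) (proj₁ (f t))))

CountersAll : (G : Graph) → ℕ → Multiset G → Set
CountersAll G k D = ∀ (A : Multiset G) → size G A ≤ k → Counters G D A

nbSum : (G : Graph) → Multiset G → Fin (n G) → ℕ
nbSum G D v = sum (map (λ u → if inN G u v then D u else 0) (allFin (n G)))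

TupleDom : (G : Graph) → ℕ → Multiset G → Set
TupleDom G k D = ∀ v → k ≤ nbSum G D v

DDSMulti : Graph → ℕ → ℕ → Set
DDSMulti G k ℓ = Σ (Multiset G) λ D → size G D ≤ ℓ × CountersAll G k D

DDSSet : Graph → ℕ → ℕ → Set
DDSSet G k ℓ = Σ (Multiset G) λ D → IsSet G D × size G D ≤ ℓ × CountersAll G k D

KTupleMulti : Graph → ℕ → ℕ → Set
KTupleMulti G k ℓ = Σ (Multiset G) λ D → size G D ≤ ℓ × TupleDom G k D

KTupleSet : Graph → ℕ → ℕ → Set
KTupleSet G k ℓ = Σ (Multiset G) λ D → IsSet G D × size G D ≤ ℓ × TupleDom G k D

-- (i) ⇒ (ii): attack v with k tokens stacked on it; the defenders countering them are
-- k distinct tokens of D lying in N[v], and there are exactly nbSum G D v of those.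
-- (ii) ⇒ (i): every attacker token sees at least k ≥ |A| defender tokens, so they can
-- be served greedily: fewer than k already assigned tokens never exhaust k candidates.
-- Both equivalences of decision problems then hold with the same witness D.
module Submission where

open import Defs hiding (sym)
open import Data.Bool using (Bool; true; false; _∨_; if_then_else_; T)
open import Data.Bool.Properties using (T-irrelevant)
open import Data.Fin using (Fin; zero; suc; inject≤; _≟_)
open import Data.Fin.Properties using (+↔⊎; inject≤-injective; injective⇒≤; any?; all?)
open import Data.List using (tabulate)
open import Data.List.Properties using (map-tabulate)
open import Data.Nat using (ℕ; zero; suc; _≤_; _<_)
open import Data.Nat.ListAction using (sum)
open import Data.Nat.Properties using (<⇒≤; <⇒≱)
open import Data.Product using (Σ; ∃; _×_; _,_; proj₁; proj₂)
open import Data.Product.Properties using (≡-dec)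
open import Data.Sum using (_⊎_; inj₁; inj₂)
open import Data.Sum.Function.Propositional using (_⊎-↔_)
open import Data.Unit using (tt)
open import Data.Vec.Functional using (_∷_)
open import Function using (_∘_; id)
open import Function.Bundles using (_⇔_; mk⇔; _↔_; mk↔ₛ′; Inverse; _↣_; mk↣; Injection)
open import Function.Construct.Composition using (_↔-∘_; _↣-∘_)
open import Function.Definitions using (Injective)
open import Function.Properties.Inverse using (↔-refl; ↔-sym; ↔⇒↣)
open import Relation.Binary.Definitions using (DecidableEquality)
open import Relation.Binary.PropositionalEquality using (_≡_; _≢_; refl; sym; trans; cong; subst; subst₂; cong₂)
open import Relation.Nullary using (Irrelevant; yes; no; ¬?; contradiction)
open import Relation.Nullary.Decidable using (⌊_⌋; toWitness; fromWitness)

Σ-suc↔⊎ : ∀ {n} {P : Fin (suc n) → Set} → Σ (Fin (suc n)) P ↔ (P zero ⊎ Σ (Fin n) (P ∘ suc))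
Σ-suc↔⊎ {n} {P} = mk↔ₛ′ split unsplit
  (λ { (inj₁ _) → refl ; (inj₂ _) → refl })
  (λ { (zero , _) → refl ; (suc _ , _) → refl })
  where
  split : Σ (Fin (suc n)) P → P zero ⊎ Σ (Fin n) (P ∘ suc)
  split (zero , p) = inj₁ p
  split (suc i , p) = inj₂ (i , p)
  unsplit : P zero ⊎ Σ (Fin n) (P ∘ suc) → Σ (Fin (suc n)) P
  unsplit (inj₁ p) = zero , p
  unsplit (inj₂ (i , p)) = suc i , p

Σ-Fin↔Fin-sum : ∀ {n} (X : Fin n → ℕ) → Σ (Fin n) (Fin ∘ X) ↔ Fin (sum (tabulate X))
Σ-Fin↔Fin-sum {zero} X = mk↔ₛ′ (λ ()) (λ ()) (λ ()) (λ ())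
Σ-Fin↔Fin-sum {suc n} X = ↔-sym +↔⊎ ↔-∘ ((↔-refl ⊎-↔ Σ-Fin↔Fin-sum (X ∘ suc)) ↔-∘ Σ-suc↔⊎)

tokens↔Fin-size : (G : Graph) (X : Multiset G) → Token G X ↔ Fin (size G X)
tokens↔Fin-size G X =
  subst (λ m → Token G X ↔ Fin m) (sym (cong sum (map-tabulate id X))) (Σ-Fin↔Fin-sum X)

restrict : ∀ {n} → (Fin n → Bool) → (Fin n → ℕ) → Fin n → ℕ
restrict P X u = if P u then X u else 0

Fin-if↔ : ∀ {m} b → Fin (if b then m else 0) ↔ (Fin m × T b)
Fin-if↔ true = mk↔ₛ′ (_, tt) proj₁ (λ _ → refl) (λ _ → refl)
Fin-if↔ false = mk↔ₛ′ (λ ()) (λ { (_ , ()) }) (λ { (_ , ()) }) (λ ())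

Σ-restrict↔ : ∀ {n} (P : Fin n → Bool) (X : Fin n → ℕ) →
  Σ (Fin n) (Fin ∘ restrict P X) ↔ Σ (Σ (Fin n) (Fin ∘ X)) (T ∘ P ∘ proj₁)
Σ-restrict↔ {n} P X = mk↔ₛ′ forget remember forget-remember remember-forget
  where
  module F u = Inverse (Fin-if↔ {X u} (P u))
  forget : Σ (Fin n) (Fin ∘ restrict P X) → Σ (Σ (Fin n) (Fin ∘ X)) (T ∘ P ∘ proj₁)
  forget (u , i) = (u , proj₁ (F.to u i)) , proj₂ (F.to u i)
  remember : Σ (Σ (Fin n) (Fin ∘ X)) (T ∘ P ∘ proj₁) → Σ (Fin n) (Fin ∘ restrict P X)
  remember ((u , j) , p) = u , F.from u (j , p)
  forget-remember : ∀ y → forget (remember y) ≡ y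
  forget-remember ((u , j) , p) = cong (λ (j′ , p′) → (u , j′) , p′) (F.strictlyInverseˡ u (j , p))
  remember-forget : ∀ x → remember (forget x) ≡ x
  remember-forget (u , i) = cong (u ,_) (F.strictlyInverseʳ u i)

proj₁-injective : ∀ {A : Set} {P : A → Set} → (∀ {a} → Irrelevant (P a)) →
  Injective _≡_ _≡_ (proj₁ {B = P})
proj₁-injective irrelevant {a , p} {.a , q} refl = cong (a ,_) (irrelevant p q)

inject≤↣ : ∀ {m n} → m ≤ n → Fin m ↣ Fin n
inject≤↣ m≤n = mk↣ (inject≤-injective m≤n m≤n _ _)

⌊≟⌋-sym : ∀ {m} (u v : Fin m) → ⌊ u ≟ v ⌋ ≡ ⌊ v ≟ u ⌋
⌊≟⌋-sym u v with u ≟ v | v ≟ u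
... | yes _ | yes _ = refl
... | no _ | no _ = refl
... | yes u≡v | no v≢u = contradiction (sym u≡v) v≢u
... | no u≢v | yes v≡u = contradiction (sym v≡u) u≢v

inN-sym : (G : Graph) (u v : Fin (n G)) → inN G u v ≡ inN G v u
inN-sym G u v = cong₂ _∨_ (⌊≟⌋-sym u v) (Graph.sym G v u)

NbTokens : (G : Graph) → Multiset G → Fin (n G) → Set
NbTokens G D v = Σ (Token G D) λ t → T (inN G (proj₁ t) v)

nbTokens↔Fin-nbSum : (G : Graph) (D : Multiset G) (v : Fin (n G)) → NbTokens G D v ↔ Fin (nbSum G D v)
nbTokens↔Fin-nbSum G D v = tokens↔Fin-size G (restrict (λ u → inN G u v) D) ↔-∘ ↔-sym (Σ-restrict↔ _ D)

nbTokens↣tokens : (G : Graph) (D : Multiset G) (v : Fin (n G)) → NbTokens G D v ↣ Token G D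
nbTokens↣tokens G D v = mk↣ (proj₁-injective T-irrelevant)

pile : (G : Graph) → Fin (n G) → ℕ → Multiset G
pile G v k = restrict (λ u → ⌊ u ≟ v ⌋) (λ _ → k)

pile-token-at : (G : Graph) (v : Fin (n G)) (k : ℕ) (t : Token G (pile G v k)) → proj₁ t ≡ v
pile-token-at G v k t = toWitness (proj₂ (Inverse.to (Σ-restrict↔ (λ u → ⌊ u ≟ v ⌋) (λ _ → k)) t))

pile-tokens↔ : (G : Graph) (v : Fin (n G)) (k : ℕ) → Token G (pile G v k) ↔ Fin k
pile-tokens↔ G v k = at-v ↔-∘ Σ-restrict↔ _ _
  where
  at-v : Σ (Σ (Fin (n G)) (λ _ → Fin k)) (λ t → T ⌊ proj₁ t ≟ v ⌋) ↔ Fin k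
  at-v = mk↔ₛ′ (proj₂ ∘ proj₁) (λ i → (v , i) , fromWitness refl) (λ _ → refl) at-v-η
    where
    at-v-η : ∀ t → ((v , proj₂ (proj₁ t)) , fromWitness refl) ≡ t
    at-v-η ((u , i) , p) with refl ← toWitness {a? = u ≟ v} p = cong ((u , i) ,_) (T-irrelevant _ p)

size-pile : (G : Graph) (v : Fin (n G)) (k : ℕ) → size G (pile G v k) ≤ k
size-pile G v k = injective⇒≤ (Injection.injective
  (↔⇒↣ (pile-tokens↔ G v k ↔-∘ ↔-sym (tokens↔Fin-size G (pile G v k)))))

module _ {B : Set} (_≟B_ : DecidableEquality B) where

  open Injection using (to; injective)

  avoid : ∀ {t s} → t < s → (h : Fin t → B) (e : Fin s ↣ B) → ∃ λ x → ∀ j → h j ≢ to e x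
  avoid t<s h e with any? (λ x → all? (λ j → ¬? (h j ≟B to e x)))
  ... | yes fresh = fresh
  ... | no no-fresh = contradiction (injective⇒≤ preimage-injective) (<⇒≱ t<s)
    where
    preimage : ∀ x → ∃ λ j → h j ≡ to e x
    preimage x with any? (λ j → h j ≟B to e x)
    ... | yes hit = hit
    ... | no miss = contradiction (x , λ j hj≡ex → miss (j , hj≡ex)) no-fresh
    preimage-injective : Injective _≡_ _≡_ (proj₁ ∘ preimage)
    preimage-injective {x} {y} same = injective e (trans (sym (proj₂ (preimage x)))
                                                      (trans (cong h same) (proj₂ (preimage y))))

  distinct-representatives : ∀ {t s} → t ≤ s → (g : Fin t → Fin s ↣ B) →
    ∃ λ (f : Fin t → B) → Injective _≡_ _≡_ f × ∀ j → ∃ λ x → f j ≡ to (g j) x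
  distinct-representatives {zero} _ g = (λ ()) , (λ { {()} }) , λ ()
  distinct-representatives {suc t} t<s g
    with f , f-injective , f-represents ← distinct-representatives (<⇒≤ t<s) (g ∘ suc)
    with x , fresh ← avoid t<s f (g zero)
    = to (g zero) x ∷ f , f⁺-injective , f⁺-represents
    where
    f⁺-injective : Injective _≡_ _≡_ (to (g zero) x ∷ f)
    f⁺-injective {zero} {zero} _ = refl
    f⁺-injective {zero} {suc j} eq = contradiction (sym eq) (fresh j)
    f⁺-injective {suc i} {zero} eq = contradiction eq (fresh i)
    f⁺-injective {suc i} {suc j} eq = cong suc (f-injective eq)
    f⁺-represents : ∀ j → ∃ λ y → (to (g zero) x ∷ f) j ≡ to (g j) y
    f⁺-represents zero = x , refl
    f⁺-represents (suc j) = f-represents j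

counters⇒tupleDom : ∀ G k D → CountersAll G k D → TupleDom G k D
counters⇒tupleDom G k D counters v =
  injective⇒≤ (Injection.injective
    (↔⇒↣ (nbTokens↔Fin-nbSum G D v) ↣-∘ (guards ↣-∘ ↔⇒↣ (↔-sym (pile-tokens↔ G v k)))))
  where
  A = pile G v k
  defense : Counters G D A
  defense = counters A (size-pile G v k)
  guards : Token G A ↣ NbTokens G D v
  guards = mk↣ {to = λ t → proj₁ defense t , near t} (proj₁ (proj₂ defense) ∘ cong proj₁)
    where
    near : ∀ t → T (inN G (proj₁ (proj₁ defense t)) v)
    near t = subst T (inN-sym G v d)
      (subst (λ a → T (inN G a d)) (pile-token-at G v k t) (proj₂ (proj₂ defense) t))
      where d = proj₁ (proj₁ defense t)

tupleDom⇒counters : ∀ G k D → TupleDom G k D → CountersAll G k D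
tupleDom⇒counters G k D dominating A |A|≤k =
  f ∘ enumerate , Injection.injective (↔⇒↣ tokensA) ∘ f-injective , near
  where
  tokensA = tokens↔Fin-size G A
  enumerate = Inverse.to tokensA
  attacker : Fin (size G A) → Fin (n G)
  attacker j = proj₁ (Inverse.from tokensA j)
  guards : ∀ j → Fin k ↣ NbTokens G D (attacker j)
  guards j = ↔⇒↣ (↔-sym (nbTokens↔Fin-nbSum G D (attacker j))) ↣-∘ inject≤↣ (dominating (attacker j))
  candidates : ∀ j → Fin k ↣ Token G D
  candidates j = nbTokens↣tokens G D (attacker j) ↣-∘ guards j
  representatives = distinct-representatives {Token G D} (≡-dec _≟_ _≟_) |A|≤k candidates
  f = proj₁ representatives
  f-injective = proj₁ (proj₂ representatives)
  near : ∀ t → T (inN G (proj₁ t) (proj₁ (f (enumerate t))))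
  near t with x , fx≡ ← proj₂ (proj₂ representatives) (enumerate t) =
    subst₂ (λ a d → T (inN G a d))
      (cong proj₁ (Inverse.strictlyInverseʳ tokensA t)) (cong proj₁ (sym fx≡))
      (subst T (inN-sym G _ _) (proj₂ (Injection.to (guards (enumerate t)) x)))

counters⇔tupleDom : ∀ G k D → CountersAll G k D ⇔ TupleDom G k D
counters⇔tupleDom G k D = mk⇔ (counters⇒tupleDom G k D) (tupleDom⇒counters G k D)

lemma10 : (∀ (G : Graph) (k : ℕ) (D : Multiset G) → CountersAll G k D ⇔ TupleDom G k D)
    × (∀ (G : Graph) (k ℓ : ℕ) → DDSSet G k ℓ ⇔ KTupleSet G k ℓ)
    × (∀ (G : Graph) (k ℓ : ℕ) → DDSMulti G k ℓ ⇔ KTupleMulti G k ℓ)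
lemma10 = counters⇔tupleDom
  , (λ G k ℓ → mk⇔ (λ (D , isSet , small , c) → D , isSet , small , counters⇒tupleDom G k D c)
                   (λ (D , isSet , small , d) → D , isSet , small , tupleDom⇒counters G k D d))
  , (λ G k ℓ → mk⇔ (λ (D , small , c) → D , small , counters⇒tupleDom G k D c)
                   (λ (D , small , d) → D , small , tupleDom⇒counters G k D d))
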